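{- Let $p \geq 5$ be a prime number and $V = (\mathbb{Z}/p^2\mathbb{Z})^2$. Let $G$ be the subgroup of $\mathrm{GL}_2(\mathbb{Z}/p^2\mathbb{Z})$ generated by $$g = \begin{pmatrix} 1 & 0 \\ 0 & -1 \end{pmatrix}, \quad \sigma = \begin{pmatrix} 1+p & 1 \\ 2p & 1+p \end{pmatrix}, \quad h = \begin{pmatrix} 1+p & 0 \\ 0 & 1-p \end{pmatrix}.$$ Then $H^1_{\mathrm{loc}}(G, V) \neq 0$.
   Context: $G$ acts on $V$ by matrix multiplication. For a group $\Gamma$ and a $\Gamma$-module $M$, a cocycle $Z \colon \Gamma \to M$ satisfies the local conditions if for every $\gamma \in \Gamma$ there exists $m_\gamma \in M$ with $Z_\gamma = \gamma(m_\gamma) - m_\gamma$; $H^1_{\mathrm{loc}}(\Gamma, M)$ is the subgroup of $H^1(\Gamma, M)$ of classes of such cocycles. -}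

module Defs where

open import Data.Nat using (ℕ; _+_; _*_; _∸_; NonZero; nonTrivial⇒nonZero)
open import Data.Nat.Properties using (m*n≢0)
open import Data.Nat.DivMod using (_mod_)
open import Data.Nat.Primality using (Prime; prime)
open import Data.Fin using (Fin; toℕ)
open import Data.Product using (_×_; _,_; ∃-syntax)
open import Relation.Binary.PropositionalEquality using (_≡_)

primeNZ : ∀ {p} → Prime p → NonZero p
primeNZ {p} (prime {{nt}} _) = nonTrivial⇒nonZero p {{nt}}

module Setup (p : ℕ) {{nzp : NonZero p}} where

  N : ℕ
  N = p * p

  instance
    nzN : NonZero N
    nzN = m*n≢0 p p

  -- the ring ℤ/p²ℤ, elements represented by their residue in Fin N
  R : Set
  R = Fin N

  [_] : ℕ → R
  [ k ] = k mod N

  infixl 6 _+R_ _-R_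
  infixl 7 _*R_

  _+R_ : R → R → R
  a +R b = (toℕ a + toℕ b) mod N

  _*R_ : R → R → R
  a *R b = (toℕ a * toℕ b) mod N

  -R_ : R → R
  -R a = (N ∸ toℕ a) mod N

  _-R_ : R → R → R
  a -R b = a +R (-R b)

  V : Set
  V = R × R

  _+V_ : V → V → V
  (x , y) +V (x' , y') = (x +R x' , y +R y')

  _-V_ : V → V → V
  (x , y) -V (x' , y') = (x -R x' , y -R y')

  -- 2×2 matrices over ℤ/p²ℤ, (a , b , c , d) stands for  [[a , b] , [c , d]]
  Mat : Set
  Mat = R × R × R × R

  _·_ : Mat → Mat → Mat
  (a , b , c , d) · (a' , b' , c' , d') =
    ( a *R a' +R b *R c' , a *R b' +R b *R d'
    , c *R a' +R d *R c' , c *R b' +R d *R d' )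

  act : Mat → V → V
  act (a , b , c , d) (x , y) = (a *R x +R b *R y , c *R x +R d *R y)

  I : Mat
  I = ([ 1 ] , [ 0 ] , [ 0 ] , [ 1 ])

  g σ h : Mat
  g = ([ 1 ] , [ 0 ] , [ 0 ] , -R [ 1 ])
  σ = ([ 1 + p ] , [ 1 ] , [ 2 * p ] , [ 1 + p ])
  h = ([ 1 + p ] , [ 0 ] , [ 0 ] , [ 1 ] -R [ p ])

  -- G = subgroup of GL₂(ℤ/p²ℤ) generated by g, σ, h.  Since GL₂(ℤ/p²ℤ) is
  -- finite, the submonoid generated by g, σ, h is already this subgroup.
  data InG : Mat → Set where
    G-one : InG I
    G-g   : InG g
    G-σ   : InG σ
    G-h   : InG h
    G-mul : ∀ {A B} → InG A → InG B → InG (A · B)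

  -- a 1-cocycle G → V (values of Z outside G are irrelevant)
  IsCocycle : (Mat → V) → Set
  IsCocycle Z = ∀ {A B} → InG A → InG B → Z (A · B) ≡ Z A +V act A (Z B)

  SatisfiesLocal : (Mat → V) → Set
  SatisfiesLocal Z = ∀ {A} → InG A → ∃[ m ] (Z A ≡ act A m -V m)

  IsCoboundary : (Mat → V) → Set
  IsCoboundary Z = ∃[ m ] (∀ {A} → InG A → Z A ≡ act A m -V m)

module Submission where

-- The cocycle  Z [[a , b] , [c , d]] = (p b² , 2p d b)  on G = ⟨g, σ, h⟩ ⊆ GL₂(ℤ/p²ℤ)
-- satisfies the local conditions but is not a coboundary, so H¹_loc(G, V) ≠ 0.
--
-- All computations happen on integer representatives modulo p², where the guiding
-- principle is that p·x modulo p² only depends on x modulo p.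
--  1. Congruences of integers: compatibility with the ring operations, scaling,
--     and the fact that modulo a prime p every integer is a multiple of p or a
--     unit modulo p² (Bézout, then Hensel lifting).
--  2. For any integer P, the sets of integer matrices
--       Γ e = { [[a , b] , [c , d]] : a ≡ 1, d ≡ e (mod P), c ≡ 2P e b (mod P²) },  e = ±1.
--     Their union Γ is closed under products, Z is a cocycle on Γ, Z satisfies the
--     local conditions on Γ (m = (0 , P b) if P ∣ b (d + 1), else m = (1 , b⁻¹ (P b² - (a - 1)))),
--     and a coboundary on g, σ, h would force 2P ≡ 0 (mod P²).
--  3. Residues in ℤ/p²ℤ are represented by integers in [0, p²); this is an injective
--     ring homomorphism modulo p², so identities in V follow from integer congruences.
--  4. The generators lie in Γ, hence so does G, and the theorem follows since
--     2p ≢ 0 (mod p²) for p ≥ 3.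

open import Defs
open import Data.Nat using (ℕ; _≤_)
open import Data.Nat.Primality using (Prime)
open import Data.Product using (_×_; ∃-syntax)
open import Relation.Nullary using (¬_)

open import Data.Nat as ℕ using (NonZero; zero; suc)
import Data.Nat.Properties as ℕ
import Data.Nat.DivMod as ℕ
open import Data.Nat.Coprimality using (prime⇒coprime; coprime-Bézout)
open import Data.Nat.GCD using (module Bézout)
open import Data.Integer as ℤ using (ℤ; +_; -_; _+_; _*_; _-_)
import Data.Integer.Properties as ℤ
import Data.Integer.DivMod as ℤ
open import Data.Fin using (toℕ)
import Data.Fin.Properties as Fin
open import Data.Integer.Tactic.RingSolver using (solve)
open import Data.List using (_∷_; [])
open import Data.Product using (_,_; proj₁; proj₂)
open import Data.Product.Relation.Binary.Pointwise.NonDependent using (Pointwise; _×ₛ_)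
open import Data.Sign as Sign using (Sign)
open import Data.Empty using (⊥; ⊥-elim)
open import Data.Sum using (_⊎_; inj₁; inj₂)
open import Relation.Binary.Bundles using (Setoid)
open import Relation.Binary.PropositionalEquality
  using (_≡_; refl; sym; trans; cong; cong₂; subst; module ≡-Reasoning)
import Relation.Binary.Reasoning.Setoid as SetoidReasoning

infix 4 _≡_mod_

record _≡_mod_ (x y m : ℤ) : Set where
  constructor congruent
  field
    quotient   : ℤ
    difference : x ≡ y + quotient * m

module _ {m : ℤ} where

  ≡⇒≡mod : ∀ {x y} → x ≡ y → x ≡ y mod m
  ≡⇒≡mod {x} refl = congruent (+ 0) (solve (x ∷ m ∷ []))

  mod-refl : ∀ {x} → x ≡ x mod m
  mod-refl = ≡⇒≡mod refl

  mod-sym : ∀ {x y} → x ≡ y mod m → y ≡ x mod m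
  mod-sym (congruent q x≡y+qm) = congruent (- q) (swap {q = q} x≡y+qm)
    where
      swap : ∀ {x y q} → x ≡ y + q * m → y ≡ x + - q * m
      swap {y = y} {q} refl = solve (y ∷ q ∷ m ∷ [])

  mod-trans : ∀ {x y z} → x ≡ y mod m → y ≡ z mod m → x ≡ z mod m
  mod-trans {z = z} (congruent q refl) (congruent r refl) =
    congruent (r + q) (solve (z ∷ q ∷ r ∷ m ∷ []))

  +-cong : ∀ {x y x′ y′} → x ≡ y mod m → x′ ≡ y′ mod m → x + x′ ≡ y + y′ mod m
  +-cong {y = y} {y′ = y′} (congruent q refl) (congruent r refl) =
    congruent (q + r) (solve (y ∷ y′ ∷ q ∷ r ∷ m ∷ []))

  *-cong : ∀ {x y x′ y′} → x ≡ y mod m → x′ ≡ y′ mod m → x * x′ ≡ y * y′ mod m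
  *-cong {y = y} {y′ = y′} (congruent q refl) (congruent r refl) =
    congruent (q * y′ + y * r + q * r * m) (solve (y ∷ y′ ∷ q ∷ r ∷ m ∷ []))

  neg-cong : ∀ {x y} → x ≡ y mod m → - x ≡ - y mod m
  neg-cong {y = y} (congruent q refl) = congruent (- q) (solve (y ∷ q ∷ m ∷ []))

  *-congˡ : ∀ k {x y} → x ≡ y mod m → k * x ≡ k * y mod m
  *-congˡ k = *-cong (mod-refl {k})

  *-congʳ : ∀ k {x y} → x ≡ y mod m → x * k ≡ y * k mod m
  *-congʳ k h = *-cong h (mod-refl {k})

  +-congˡ : ∀ k {x y} → x ≡ y mod m → k + x ≡ k + y mod m
  +-congˡ k = +-cong (mod-refl {k})

  +-congʳ : ∀ k {x y} → x ≡ y mod m → x + k ≡ y + k mod m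
  +-congʳ k h = +-cong h (mod-refl {k})

  difference≡0 : ∀ {x y} → x ≡ y mod m → x - y ≡ + 0 mod m
  difference≡0 {y = y} x≡y = mod-trans (+-congʳ (- y) x≡y) (≡⇒≡mod (ℤ.+-inverseʳ y))

  add-modulus : ∀ x → x + m ≡ x mod m
  add-modulus x = congruent (+ 1) (cong (λ w → x + w) (sym (ℤ.*-identityˡ m)))

  subtract-modulus : ∀ x → x - m ≡ x mod m
  subtract-modulus x = congruent (- + 1) (cong (λ w → x + w) (sym (ℤ.-1*i≡-i m)))

  modSetoid : Setoid _ _
  modSetoid = record
    { Carrier = ℤ ; _≈_ = λ x y → x ≡ y mod m
    ; isEquivalence = record { refl = mod-refl ; sym = mod-sym ; trans = mod-trans } }

  multiple≡0 : ∀ x → m * x ≡ + 0 mod m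
  multiple≡0 x = congruent x (solve (m ∷ x ∷ []))

weaken : ∀ {m n x y} → x ≡ y mod m * n → x ≡ y mod m
weaken {m} {n} {y = y} (congruent q refl) = congruent (q * n) (solve (y ∷ q ∷ m ∷ n ∷ []))

scale : ∀ k {m x y} → x ≡ y mod m → k * x ≡ k * y mod k * m
scale k {m} {y = y} (congruent q refl) = congruent q (solve (k ∷ y ∷ q ∷ m ∷ []))

multiples-* : ∀ {m n x y} → x ≡ + 0 mod m → y ≡ + 0 mod n → x * y ≡ + 0 mod m * n
multiples-* {m} {n} (congruent q refl) (congruent r refl) =
  congruent (q * r) (solve (q ∷ r ∷ m ∷ n ∷ []))

-- Hensel lifting: an inverse of b modulo m improves to one modulo m²
hensel : ∀ {m u b} → u * b ≡ + 1 mod m → (u * (+ 2 - u * b)) * b ≡ + 1 mod m * m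
hensel {m} {u} {b} (congruent q eq) = congruent (- (q * q)) (begin
    (u * (+ 2 - u * b)) * b   ≡⟨ solve (u ∷ b ∷ []) ⟩
    (u * b) * (+ 2 - u * b)   ≡⟨ cong (λ w → w * (+ 2 - w)) eq ⟩
    (+ 1 + q * m) * (+ 2 - (+ 1 + q * m))  ≡⟨ solve (q ∷ m ∷ []) ⟩
    + 1 + - (q * q) * (m * m)  ∎)
  where open ≡-Reasoning

residue : ∀ b n .{{_ : NonZero n}} → b ≡ + (b ℤ.%ℕ n) mod + n
residue b n = congruent (b ℤ./ℕ n) (ℤ.a≡a%ℕn+[a/ℕn]*n b n)

cast-to-ℤ : ∀ {k y r x p} → k ℕ.+ y ℕ.* r ≡ x ℕ.* p → + k + + y * + r ≡ + x * + p
cast-to-ℤ {k} {y} {r} {x} {p} eq = begin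
  + k + + y * + r     ≡⟨ cong (λ w → + k + w) (sym (ℤ.pos-* y r)) ⟩
  + k + + (y ℕ.* r)   ≡⟨ sym (ℤ.pos-+ k (y ℕ.* r)) ⟩
  + (k ℕ.+ y ℕ.* r)   ≡⟨ cong +_ eq ⟩
  + (x ℕ.* p)         ≡⟨ ℤ.pos-* x p ⟩
  + x * + p           ∎
  where open ≡-Reasoning

bézout-inverse : ∀ {p r} → Bézout.Identity 1 p r → ∃[ u ] u * + r ≡ + 1 mod + p
bézout-inverse {p} {r} (Bézout.+- x y eq) =
  - + y , negated (+ y) (+ r) (+ x) (+ p) (cast-to-ℤ {1} {y} {r} {x} {p} eq)
  where
    negated : ∀ y r x p → + 1 + y * r ≡ x * p → - y * r ≡ + 1 mod p
    negated y r x p e = congruent (- x) (begin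
      - y * r               ≡⟨ solve (y ∷ r ∷ []) ⟩
      + 1 - (+ 1 + y * r)   ≡⟨ cong (λ w → + 1 - w) e ⟩
      + 1 - x * p           ≡⟨ solve (x ∷ p ∷ []) ⟩
      + 1 + - x * p         ∎)
      where open ≡-Reasoning
bézout-inverse {p} {r} (Bézout.-+ x y eq) =
  + y , congruent (+ x) (sym (cast-to-ℤ {1} {x} {p} {y} {r} eq))

multiple-or-unit : ∀ {p} → Prime p → ∀ b → b ≡ + 0 mod + p ⊎ ∃[ u ] u * b ≡ + 1 mod + p
multiple-or-unit {p} pr b with b ℤ.%ℕ p | residue b p | ℤ.n%ℕd<d b p
  where instance _ = primeNZ pr
... | zero  | b≡0 | _   = inj₁ b≡0
... | suc k | b≡r | r<p with bézout-inverse (coprime-Bézout (prime⇒coprime pr r<p))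
...   | u , ur≡1 = inj₂ (u , mod-trans (*-congˡ u b≡r) ur≡1)

multiple-or-unit² : ∀ {p} → Prime p → ∀ b →
                    b ≡ + 0 mod + p ⊎ ∃[ u ] u * b ≡ + 1 mod + p * + p
multiple-or-unit² pr b with multiple-or-unit pr b
... | inj₁ b≡0       = inj₁ b≡0
... | inj₂ (u , ub≡1) = inj₂ (u * (+ 2 - u * b) , hensel {u = u} {b} ub≡1)

two-p-incongruent : ∀ {p} → 3 ℕ.≤ p → ¬ (+ 2 * + p ≡ + 0 mod + p * + p)
two-p-incongruent {p} 3≤p (congruent q eq) = impossible ∣q∣ 2≡∣q∣p
  where
    instance
      p≢0 : NonZero p
      p≢0 = ℕ.>-nonZero (ℕ.≤-trans (ℕ.s≤s ℕ.z≤n) 3≤p)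
    regroup : ∀ P q → + 0 + q * (P * P) ≡ (q * P) * P
    regroup P q = solve (P ∷ q ∷ [])
    2≡qp : + 2 ≡ q * + p
    2≡qp = ℤ.*-cancelʳ-≡ (+ 2) (q * + p) (+ p) (trans eq (regroup (+ p) q))
    ∣q∣ = ℤ.∣ q ∣
    2≡∣q∣p : 2 ≡ ∣q∣ ℕ.* p
    2≡∣q∣p = trans (cong ℤ.∣_∣ 2≡qp) (ℤ.abs-* q (+ p))
    impossible : ∀ k → 2 ≡ k ℕ.* p → ⊥
    impossible zero    ()
    impossible (suc k) 2≡p+kp =
      ℕ.<⇒≱ (ℕ.s≤s (ℕ.s≤s (ℕ.s≤s ℕ.z≤n)))
            (ℕ.≤-trans 3≤p (ℕ.≤-trans (ℕ.m≤m+n p (k ℕ.* p)) (ℕ.≤-reflexive (sym 2≡p+kp))))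

overshoot : ∀ {m a b k} → a ℕ.< m → + a ≡ + b + + suc k * + m → ⊥
overshoot {m} {a} {b} {k} a<m eq = ℕ.<⇒≱ a<m (begin
    m                      ≤⟨ ℕ.m≤m+n m (k ℕ.* m) ⟩
    suc k ℕ.* m            ≤⟨ ℕ.m≤n+m (suc k ℕ.* m) b ⟩
    b ℕ.+ suc k ℕ.* m      ≡⟨ ℤ.+-injective (trans as-ℤ (sym eq)) ⟩
    a                      ∎)
  where
    open ℕ.≤-Reasoning
    as-ℤ : + (b ℕ.+ suc k ℕ.* m) ≡ + b + + suc k * + m
    as-ℤ = trans (ℤ.pos-+ b (suc k ℕ.* m)) (cong (λ w → + b + w) (ℤ.pos-* (suc k) m))

below-modulus-injective : ∀ {m a b} → a ℕ.< m → b ℕ.< m → + a ≡ + b mod + m → a ≡ b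
below-modulus-injective _ _ (congruent (+ zero) eq) = ℤ.+-injective (trans eq (ℤ.+-identityʳ _))
below-modulus-injective a<m _ (congruent ℤ.+[1+ k ] eq) = ⊥-elim (overshoot {k = k} a<m eq)
below-modulus-injective _ b<m a≡b@(congruent ℤ.-[1+ k ] _) =
  ⊥-elim (overshoot {k = k} b<m (_≡_mod_.difference (mod-sym a≡b)))

⟦_⟧ : Sign → ℤ
⟦ Sign.+ ⟧ = + 1
⟦ Sign.- ⟧ = - + 1

⟦⟧-* : ∀ s t → ⟦ s Sign.* t ⟧ ≡ ⟦ s ⟧ * ⟦ t ⟧
⟦⟧-* Sign.+ Sign.+ = refl
⟦⟧-* Sign.+ Sign.- = refl
⟦⟧-* Sign.- Sign.+ = refl
⟦⟧-* Sign.- Sign.- = refl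

⟦⟧-square : ∀ s → ⟦ s ⟧ * ⟦ s ⟧ ≡ + 1
⟦⟧-square Sign.+ = refl
⟦⟧-square Sign.- = refl

module IntegerMatrices (P : ℤ) where

  Vecℤ : Set
  Vecℤ = ℤ × ℤ

  Matℤ : Set
  Matℤ = ℤ × ℤ × ℤ × ℤ

  infixl 6 _+ᵛ_ _-ᵛ_
  infixl 7 _·ᶻ_
  infix 4 _≈_ _≈ᵛ_ _≈ᴹ_

  _+ᵛ_ _-ᵛ_ : Vecℤ → Vecℤ → Vecℤ
  (x , y) +ᵛ (x′ , y′) = (x + x′ , y + y′)
  (x , y) -ᵛ (x′ , y′) = (x - x′ , y - y′)

  _·ᶻ_ : Matℤ → Matℤ → Matℤ
  (a , b , c , d) ·ᶻ (a′ , b′ , c′ , d′) =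
    (a * a′ + b * c′ , a * b′ + b * d′ , c * a′ + d * c′ , c * b′ + d * d′)

  actᶻ : Matℤ → Vecℤ → Vecℤ
  actᶻ (a , b , c , d) (x , y) = (a * x + b * y , c * x + d * y)

  _≈_ : ℤ → ℤ → Set
  x ≈ y = x ≡ y mod P * P

  _≈ᵛ_ : Vecℤ → Vecℤ → Set
  _≈ᵛ_ = Pointwise _≈_ _≈_

  _≈ᴹ_ : Matℤ → Matℤ → Set
  _≈ᴹ_ = Pointwise _≈_ (Pointwise _≈_ (Pointwise _≈_ _≈_))

  vecSetoid matSetoid : Setoid _ _
  vecSetoid = S ×ₛ S where S = modSetoid {P * P}
  matSetoid = S ×ₛ (S ×ₛ (S ×ₛ S)) where S = modSetoid {P * P}

  open Setoid vecSetoid public using ()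
    renaming (refl to ≈ᵛ-refl; sym to ≈ᵛ-sym; trans to ≈ᵛ-trans)
  open Setoid matSetoid public using () renaming (refl to ≈ᴹ-refl; sym to ≈ᴹ-sym)

  +ᵛ-cong : ∀ {u u′ v v′} → u ≈ᵛ u′ → v ≈ᵛ v′ → u +ᵛ v ≈ᵛ u′ +ᵛ v′
  +ᵛ-cong (x≈ , y≈) (x′≈ , y′≈) = +-cong x≈ x′≈ , +-cong y≈ y′≈

  -ᵛ-cong : ∀ {u u′ v v′} → u ≈ᵛ u′ → v ≈ᵛ v′ → u -ᵛ v ≈ᵛ u′ -ᵛ v′
  -ᵛ-cong (x≈ , y≈) (x′≈ , y′≈) = +-cong x≈ (neg-cong x′≈) , +-cong y≈ (neg-cong y′≈)

  act-cong : ∀ {A B v w} → A ≈ᴹ B → v ≈ᵛ w → actᶻ A v ≈ᵛ actᶻ B w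
  act-cong (a≈ , b≈ , c≈ , d≈) (x≈ , y≈) =
    +-cong (*-cong a≈ x≈) (*-cong b≈ y≈) , +-cong (*-cong c≈ x≈) (*-cong d≈ y≈)

  Zᶻ : Matℤ → Vecℤ
  Zᶻ (a , b , c , d) = (P * (b * b) , P * (+ 2 * (d * b)))

  Zᶻ-cong : ∀ {A B} → A ≈ᴹ B → Zᶻ A ≈ᵛ Zᶻ B
  Zᶻ-cong (_ , b≈ , _ , d≈) =
    *-congˡ P (*-cong b≈ b≈) , *-congˡ P (*-congˡ (+ 2) (*-cong d≈ b≈))

  InΓ : ℤ → Matℤ → Set
  InΓ e (a , b , c , d) =
    (a ≡ + 1 mod P) × (d ≡ e mod P) × (c ≡ P * (+ 2 * (e * b)) mod P * P)

  InΓ-cong : ∀ {e A B} → A ≈ᴹ B → InΓ e A → InΓ e B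
  InΓ-cong {e} (a≈ , b≈ , c≈ , d≈) (a≡1 , d≡e , c≡) =
    mod-trans (mod-sym (weaken a≈)) a≡1 ,
    mod-trans (mod-sym (weaken d≈)) d≡e ,
    mod-trans (mod-sym c≈) (mod-trans c≡ (scale P (*-congˡ (+ 2) (*-congˡ e (weaken b≈)))))

  lower-left≡0 : ∀ {c X} → c ≡ P * X mod P * P → c ≡ + 0 mod P
  lower-left≡0 {X = X} c≡ = mod-trans (weaken c≡) (multiple≡0 X)

  -- The entries of a product of elements of Γ e and Γ f; the identity f² = 1
  -- is what makes Γ closed and Z a cocycle.
  module Product {e f a₁ b₁ c₁ d₁ a₂ b₂ c₂ d₂ : ℤ} (f²≡1 : f * f ≡ + 1)
    (A∈Γ : InΓ e (a₁ , b₁ , c₁ , d₁)) (B∈Γ : InΓ f (a₂ , b₂ , c₂ , d₂)) where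

    private
      a₁≡1 = proj₁ A∈Γ
      d₁≡e = proj₁ (proj₂ A∈Γ)
      c₁≡  = proj₂ (proj₂ A∈Γ)
      a₂≡1 = proj₁ B∈Γ
      d₂≡f = proj₁ (proj₂ B∈Γ)
      c₂≡  = proj₂ (proj₂ B∈Γ)

    a-product : a₁ * a₂ + b₁ * c₂ ≡ + 1 mod P
    a-product = begin
      a₁ * a₂ + b₁ * c₂      ≈⟨ +-cong (*-cong a₁≡1 a₂≡1) (*-congˡ b₁ (lower-left≡0 c₂≡)) ⟩
      + 1 * + 1 + b₁ * + 0   ≡⟨ solve (b₁ ∷ []) ⟩
      + 1                    ∎
      where open SetoidReasoning (modSetoid {P})

    b-product : a₁ * b₂ + b₁ * d₂ ≡ b₂ + f * b₁ mod P
    b-product = begin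
      a₁ * b₂ + b₁ * d₂    ≈⟨ +-cong (*-congʳ b₂ a₁≡1) (*-congˡ b₁ d₂≡f) ⟩
      + 1 * b₂ + b₁ * f    ≡⟨ solve (b₁ ∷ b₂ ∷ f ∷ []) ⟩
      b₂ + f * b₁          ∎
      where open SetoidReasoning (modSetoid {P})

    d-product : c₁ * b₂ + d₁ * d₂ ≡ e * f mod P
    d-product = begin
      c₁ * b₂ + d₁ * d₂    ≈⟨ +-cong (*-congʳ b₂ (lower-left≡0 c₁≡)) (*-cong d₁≡e d₂≡f) ⟩
      + 0 * b₂ + e * f     ≡⟨ solve (b₂ ∷ e ∷ f ∷ []) ⟩
      e * f                ∎
      where open SetoidReasoning (modSetoid {P})

    c-product : c₁ * a₂ + d₁ * c₂ ≡ P * (+ 2 * ((e * f) * (a₁ * b₂ + b₁ * d₂))) mod P * P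
    c-product = begin
      c₁ * a₂ + d₁ * c₂
        ≈⟨ +-cong (*-congʳ a₂ c₁≡) (*-congˡ d₁ c₂≡) ⟩
      P * (+ 2 * (e * b₁)) * a₂ + d₁ * (P * (+ 2 * (f * b₂)))
        ≡⟨ solve (P ∷ e ∷ f ∷ b₁ ∷ b₂ ∷ a₂ ∷ d₁ ∷ []) ⟩
      P * ((+ 2 * e * b₁) * a₂ + (+ 2 * f * b₂) * d₁)
        ≈⟨ scale P (+-cong (*-congˡ (+ 2 * e * b₁) a₂≡1) (*-congˡ (+ 2 * f * b₂) d₁≡e)) ⟩
      P * ((+ 2 * e * b₁) * + 1 + (+ 2 * f * b₂) * e)
        ≡⟨ cong (λ w → P * ((+ 2 * e * b₁) * w + (+ 2 * f * b₂) * e)) (sym f²≡1) ⟩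
      P * ((+ 2 * e * b₁) * (f * f) + (+ 2 * f * b₂) * e)
        ≡⟨ solve (P ∷ e ∷ f ∷ b₁ ∷ b₂ ∷ []) ⟩
      P * (+ 2 * ((e * f) * (b₂ + f * b₁)))
        ≈⟨ mod-sym (scale P (*-congˡ (+ 2) (*-congˡ (e * f) b-product))) ⟩
      P * (+ 2 * ((e * f) * (a₁ * b₂ + b₁ * d₂)))
        ∎
      where open SetoidReasoning (modSetoid {P * P})

    cocycle : Zᶻ ((a₁ , b₁ , c₁ , d₁) ·ᶻ (a₂ , b₂ , c₂ , d₂))
              ≈ᵛ Zᶻ (a₁ , b₁ , c₁ , d₁) +ᵛ actᶻ (a₁ , b₁ , c₁ , d₁) (Zᶻ (a₂ , b₂ , c₂ , d₂))
    cocycle = first , second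
      where
        open SetoidReasoning (modSetoid {P * P})
        first : P * ((a₁ * b₂ + b₁ * d₂) * (a₁ * b₂ + b₁ * d₂))
                ≈ P * (b₁ * b₁) + (a₁ * (P * (b₂ * b₂)) + b₁ * (P * (+ 2 * (d₂ * b₂))))
        first = begin
          P * ((a₁ * b₂ + b₁ * d₂) * (a₁ * b₂ + b₁ * d₂))
            ≈⟨ scale P (*-cong b-product b-product) ⟩
          P * ((b₂ + f * b₁) * (b₂ + f * b₁))
            ≡⟨ solve (P ∷ f ∷ b₁ ∷ b₂ ∷ []) ⟩
          P * (b₂ * b₂ + (f * f) * (b₁ * b₁) + + 2 * b₁ * b₂ * f)
            ≡⟨ cong (λ w → P * (b₂ * b₂ + w * (b₁ * b₁) + + 2 * b₁ * b₂ * f)) f²≡1 ⟩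
          P * (b₂ * b₂ + + 1 * (b₁ * b₁) + + 2 * b₁ * b₂ * f)
            ≡⟨ solve (P ∷ f ∷ b₁ ∷ b₂ ∷ []) ⟩
          P * (b₁ * b₁ + + 1 * (b₂ * b₂) + (+ 2 * b₁ * b₂) * f)
            ≈⟨ mod-sym (scale P (+-cong (+-congˡ (b₁ * b₁) (*-congʳ (b₂ * b₂) a₁≡1))
                                         (*-congˡ (+ 2 * b₁ * b₂) d₂≡f))) ⟩
          P * (b₁ * b₁ + a₁ * (b₂ * b₂) + (+ 2 * b₁ * b₂) * d₂)
            ≡⟨ solve (P ∷ a₁ ∷ b₁ ∷ b₂ ∷ d₂ ∷ []) ⟩
          P * (b₁ * b₁) + (a₁ * (P * (b₂ * b₂)) + b₁ * (P * (+ 2 * (d₂ * b₂))))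
            ∎
        c₁-kills : c₁ * (P * (b₂ * b₂)) ≈ + 0
        c₁-kills = multiples-* (lower-left≡0 c₁≡) (multiple≡0 (b₂ * b₂))
        second : P * (+ 2 * ((c₁ * b₂ + d₁ * d₂) * (a₁ * b₂ + b₁ * d₂)))
                 ≈ P * (+ 2 * (d₁ * b₁)) + (c₁ * (P * (b₂ * b₂)) + d₁ * (P * (+ 2 * (d₂ * b₂))))
        second = begin
          P * (+ 2 * ((c₁ * b₂ + d₁ * d₂) * (a₁ * b₂ + b₁ * d₂)))
            ≈⟨ scale P (*-congˡ (+ 2) (*-cong d-product b-product)) ⟩
          P * (+ 2 * ((e * f) * (b₂ + f * b₁)))
            ≡⟨ solve (P ∷ e ∷ f ∷ b₁ ∷ b₂ ∷ []) ⟩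
          P * (+ 2 * e * b₁ * (f * f) + + 2 * e * f * b₂)
            ≡⟨ cong (λ w → P * (+ 2 * e * b₁ * w + + 2 * e * f * b₂)) f²≡1 ⟩
          P * (+ 2 * e * b₁ * + 1 + + 2 * e * f * b₂)
            ≡⟨ solve (P ∷ e ∷ f ∷ b₁ ∷ b₂ ∷ []) ⟩
          P * ((+ 2 * b₁) * e + (+ 2 * b₂) * (e * f))
            ≈⟨ mod-sym (scale P (+-cong (*-congˡ (+ 2 * b₁) d₁≡e)
                                         (*-congˡ (+ 2 * b₂) (*-cong d₁≡e d₂≡f)))) ⟩
          P * ((+ 2 * b₁) * d₁ + (+ 2 * b₂) * (d₁ * d₂))
            ≡⟨ solve (P ∷ b₁ ∷ b₂ ∷ d₁ ∷ d₂ ∷ []) ⟩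
          P * (+ 2 * (d₁ * b₁)) + (+ 0 + d₁ * (P * (+ 2 * (d₂ * b₂))))
            ≈⟨ mod-sym (+-congˡ (P * (+ 2 * (d₁ * b₁)))
                                (+-congʳ (d₁ * (P * (+ 2 * (d₂ * b₂)))) c₁-kills)) ⟩
          P * (+ 2 * (d₁ * b₁)) + (c₁ * (P * (b₂ * b₂)) + d₁ * (P * (+ 2 * (d₂ * b₂))))
            ∎

  Γ-closed : ∀ s t {A B} → InΓ ⟦ s ⟧ A → InΓ ⟦ t ⟧ B → InΓ ⟦ s Sign.* t ⟧ (A ·ᶻ B)
  Γ-closed s t {_ , _ , _ , _} {_ , _ , _ , _} A∈Γ B∈Γ =
    subst (λ e → InΓ e _) (sym (⟦⟧-* s t)) (a-product , d-product , c-product)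
    where open Product (⟦⟧-square t) A∈Γ B∈Γ

  cocycle-identity : ∀ s t {A B} → InΓ ⟦ s ⟧ A → InΓ ⟦ t ⟧ B →
                     Zᶻ (A ·ᶻ B) ≈ᵛ Zᶻ A +ᵛ actᶻ A (Zᶻ B)
  cocycle-identity s t {_ , _ , _ , _} {_ , _ , _ , _} A∈Γ B∈Γ =
    Product.cocycle (⟦⟧-square t) A∈Γ B∈Γ

  local-by-multiple : ∀ {a b c d} → b * (d + + 1) ≡ + 0 mod P →
    Zᶻ (a , b , c , d) ≈ᵛ actᶻ (a , b , c , d) (+ 0 , P * b) -ᵛ (+ 0 , P * b)
  local-by-multiple {a} {b} {c} {d} P∣b[d+1] =
    ≡⇒≡mod first , (begin
      P * (+ 2 * (d * b))
        ≡⟨ solve (P ∷ b ∷ c ∷ d ∷ []) ⟩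
      (c * + 0 + d * (P * b)) - P * b + P * (b * (d + + 1))
        ≈⟨ +-congˡ ((c * + 0 + d * (P * b)) - P * b) (scale P P∣b[d+1]) ⟩
      (c * + 0 + d * (P * b)) - P * b + P * + 0
        ≡⟨ solve (P ∷ b ∷ c ∷ d ∷ []) ⟩
      (c * + 0 + d * (P * b)) - P * b
        ∎)
    where
      open SetoidReasoning (modSetoid {P * P})
      first : P * (b * b) ≡ (a * + 0 + b * (P * b)) - + 0
      first = solve (P ∷ a ∷ b ∷ [])

  local-by-unit : ∀ {a b c d u} → InΓ (+ 1) (a , b , c , d) → u * b ≡ + 1 mod P * P →
    let m = (+ 1 , u * (P * (b * b) - (a - + 1)))
    in Zᶻ (a , b , c , d) ≈ᵛ actᶻ (a , b , c , d) m -ᵛ m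
  local-by-unit {a} {b} {c} {d} {u} (a≡1 , d≡1 , c≡) ub≡1 = first , second
    where
      open SetoidReasoning (modSetoid {P * P})
      y = u * (P * (b * b) - (a - + 1))
      first : P * (b * b) ≈ (a * + 1 + b * y) - + 1
      first = begin
        P * (b * b)
          ≡⟨ solve (P ∷ a ∷ b ∷ []) ⟩
        (a - + 1) + + 1 * (P * (b * b) - (a - + 1))
          ≈⟨ mod-sym (+-congˡ (a - + 1) (*-congʳ (P * (b * b) - (a - + 1)) ub≡1)) ⟩
        (a - + 1) + (u * b) * (P * (b * b) - (a - + 1))
          ≡⟨ solve (P ∷ a ∷ b ∷ u ∷ []) ⟩
        (a * + 1 + b * (u * (P * (b * b) - (a - + 1)))) - + 1
          ∎
      -- y is a multiple of P since P b² and a - 1 are; with d - 1 ≡ 0 (mod P)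
      -- this makes (d - 1) y vanish modulo P²
      y≡0 : y ≡ + 0 mod P
      y≡0 = mod-trans (*-congˡ u (+-cong (multiple≡0 (b * b)) (neg-cong (difference≡0 a≡1))))
                      (≡⇒≡mod (solve (u ∷ [])))
      second : P * (+ 2 * (d * b)) ≈ (c * + 1 + d * y) - y
      second = begin
        P * (+ 2 * (d * b))
          ≈⟨ scale P (*-congˡ (+ 2) (*-congʳ b d≡1)) ⟩
        P * (+ 2 * (+ 1 * b))
          ≈⟨ mod-sym c≡ ⟩
        c
          ≡⟨ solve (c ∷ []) ⟩
        c + + 0
          ≈⟨ mod-sym (+-congˡ c (multiples-* (difference≡0 d≡1) y≡0)) ⟩
        c + (d - + 1) * y
          ≡⟨ regroup c d y ⟩
        (c * + 1 + d * y) - y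
          ∎
        where
          regroup : ∀ c d y → c + (d - + 1) * y ≡ (c * + 1 + d * y) - y
          regroup c d y = solve (c ∷ d ∷ y ∷ [])

  local-condition : (∀ b → b ≡ + 0 mod P ⊎ ∃[ u ] u * b ≡ + 1 mod P * P) →
                    ∀ s {A} → InΓ ⟦ s ⟧ A → ∃[ m ] Zᶻ A ≈ᵛ actᶻ A m -ᵛ m
  local-condition _ Sign.- {a , b , c , d} (_ , d≡-1 , _) =
    (+ 0 , P * b) , local-by-multiple {a} {b} {c} {d}
      (mod-trans (*-congˡ b (+-congʳ (+ 1) d≡-1)) (≡⇒≡mod (solve (b ∷ []))))
  local-condition dichotomy Sign.+ {a , b , c , d} A∈Γ with dichotomy b
  ... | inj₁ b≡0        = (+ 0 , P * b) , local-by-multiple {a} {b} {c} {d}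
                            (mod-trans (*-congʳ (d + + 1) b≡0) (≡⇒≡mod (solve (d ∷ []))))
  ... | inj₂ (u , ub≡1) = _ , local-by-unit {a} {b} {c} {d} {u} A∈Γ ub≡1

  Iᶻ gᶻ σᶻ hᶻ : Matℤ
  Iᶻ = (+ 1 , + 0 , + 0 , + 1)
  gᶻ = (+ 1 , + 0 , + 0 , - + 1)
  σᶻ = (+ 1 + P , + 1 , + 2 * P , + 1 + P)
  hᶻ = (+ 1 + P , + 0 , + 0 , + 1 - P)

  I∈Γ : InΓ ⟦ Sign.+ ⟧ Iᶻ
  I∈Γ = mod-refl , mod-refl , ≡⇒≡mod (sym (ℤ.*-zeroʳ P))

  g∈Γ : InΓ ⟦ Sign.- ⟧ gᶻ
  g∈Γ = mod-refl , mod-refl , ≡⇒≡mod (sym (ℤ.*-zeroʳ P))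

  σ∈Γ : InΓ ⟦ Sign.+ ⟧ σᶻ
  σ∈Γ = add-modulus (+ 1) , add-modulus (+ 1) , ≡⇒≡mod (ℤ.*-comm (+ 2) P)

  h∈Γ : InΓ ⟦ Sign.+ ⟧ hᶻ
  h∈Γ = add-modulus (+ 1) , subtract-modulus (+ 1) , ≡⇒≡mod (sym (ℤ.*-zeroʳ P))

  -- If Z were the coboundary of m = (x , y) on g, σ and h, then
  -- 2y ≡ 0 (from g), P x + y ≡ P (from σ) and P x ≡ 0 (from h), so 2P ≡ 0 mod P².
  coboundary-obstruction : ∀ {m} →
    Zᶻ gᶻ ≈ᵛ actᶻ gᶻ m -ᵛ m → Zᶻ σᶻ ≈ᵛ actᶻ σᶻ m -ᵛ m → Zᶻ hᶻ ≈ᵛ actᶻ hᶻ m -ᵛ m →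
    + 2 * P ≈ + 0
  coboundary-obstruction {x , y} (_ , on-g) (on-σ , _) (on-h , _) = begin
    + 2 * P
      ≡⟨ solve (P ∷ []) ⟩
    + 2 * (P * (+ 1 * + 1))
      ≈⟨ *-congˡ (+ 2) on-σ ⟩
    + 2 * (((+ 1 + P) * x + + 1 * y) - x)
      ≡⟨ solve (P ∷ x ∷ y ∷ []) ⟩
    + 2 * (((+ 1 + P) * x + + 0 * y) - x) - ((+ 0 * x + - + 1 * y) - y)
      ≈⟨ mod-sym (+-cong (*-congˡ (+ 2) on-h) (neg-cong on-g)) ⟩
    + 2 * (P * (+ 0 * + 0)) - P * (+ 2 * (- + 1 * + 0))
      ≡⟨ solve (P ∷ []) ⟩
    + 0
      ∎
    where open SetoidReasoning (modSetoid {P * P})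

module Representatives (p : ℕ) {{_ : NonZero p}} where
  open Setup p
  open IntegerMatrices (+ p)

  ⌜_⌝ : R → ℤ
  ⌜ a ⌝ = + toℕ a

  reduce : ℤ → R
  reduce z = (z ℤ.%ℕ N) ℕ.mod N

  private
    modulus : + N ≡ + p * + p
    modulus = ℤ.pos-* p p

    from-N : ∀ {x y} → x ≡ y mod + N → x ≈ y
    from-N = subst (λ m → _ ≡ _ mod m) modulus

    to-N : ∀ {x y} → x ≈ y → x ≡ y mod + N
    to-N = subst (λ m → _ ≡ _ mod m) (sym modulus)

  ⌜mod⌝ : ∀ k → ⌜ k ℕ.mod N ⌝ ≈ + k
  ⌜mod⌝ k = mod-trans (≡⇒≡mod (cong +_ (Fin.toℕ-fromℕ< (ℕ.m%n<n k N))))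
                      (from-N (mod-sym (residue (+ k) N)))

  reduce-correct : ∀ z → ⌜ reduce z ⌝ ≈ z
  reduce-correct z = mod-trans (⌜mod⌝ (z ℤ.%ℕ N)) (from-N (mod-sym (residue z N)))

  ⌜⌝-injective : ∀ {a b} → ⌜ a ⌝ ≈ ⌜ b ⌝ → a ≡ b
  ⌜⌝-injective {a} {b} a≈b =
    Fin.toℕ-injective (below-modulus-injective (Fin.toℕ<n a) (Fin.toℕ<n b) (to-N a≈b))

  ⌜⌝-+ : ∀ a b → ⌜ a +R b ⌝ ≈ ⌜ a ⌝ + ⌜ b ⌝
  ⌜⌝-+ a b = mod-trans (⌜mod⌝ (toℕ a ℕ.+ toℕ b)) (≡⇒≡mod (ℤ.pos-+ (toℕ a) (toℕ b)))

  ⌜⌝-* : ∀ a b → ⌜ a *R b ⌝ ≈ ⌜ a ⌝ * ⌜ b ⌝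
  ⌜⌝-* a b = mod-trans (⌜mod⌝ (toℕ a ℕ.* toℕ b)) (≡⇒≡mod (ℤ.pos-* (toℕ a) (toℕ b)))

  ⌜⌝-neg : ∀ a → ⌜ -R a ⌝ ≈ - ⌜ a ⌝
  ⌜⌝-neg a = mod-trans (⌜mod⌝ (N ℕ.∸ toℕ a))
                       (from-N (mod-trans (≡⇒≡mod N∸a) (add-modulus (- ⌜ a ⌝))))
    where
      open ≡-Reasoning
      N∸a : + (N ℕ.∸ toℕ a) ≡ - ⌜ a ⌝ + + N
      N∸a = begin
        + (N ℕ.∸ toℕ a)  ≡⟨ ℤ.⊖-≥ (ℕ.<⇒≤ (Fin.toℕ<n a)) ⟨
        N ℤ.⊖ toℕ a      ≡⟨ ℤ.m-n≡m⊖n N (toℕ a) ⟨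
        + N - ⌜ a ⌝      ≡⟨ ℤ.+-comm (+ N) (- ⌜ a ⌝) ⟩
        - ⌜ a ⌝ + + N    ∎

  ⌜⌝-- : ∀ a b → ⌜ a -R b ⌝ ≈ ⌜ a ⌝ - ⌜ b ⌝
  ⌜⌝-- a b = mod-trans (⌜⌝-+ a (-R b)) (+-congˡ ⌜ a ⌝ (⌜⌝-neg b))

  ⌜⌝-dot : ∀ a x b y → ⌜ a *R x +R b *R y ⌝ ≈ ⌜ a ⌝ * ⌜ x ⌝ + ⌜ b ⌝ * ⌜ y ⌝
  ⌜⌝-dot a x b y = mod-trans (⌜⌝-+ (a *R x) (b *R y)) (+-cong (⌜⌝-* a x) (⌜⌝-* b y))

  ⌜_⌝ᵛ : V → Vecℤ
  ⌜ x , y ⌝ᵛ = (⌜ x ⌝ , ⌜ y ⌝)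

  ⌜_⌝ᴹ : Mat → Matℤ
  ⌜ a , b , c , d ⌝ᴹ = (⌜ a ⌝ , ⌜ b ⌝ , ⌜ c ⌝ , ⌜ d ⌝)

  reduceᵛ : Vecℤ → V
  reduceᵛ (x , y) = (reduce x , reduce y)

  reduceᵛ-correct : ∀ w → ⌜ reduceᵛ w ⌝ᵛ ≈ᵛ w
  reduceᵛ-correct (x , y) = reduce-correct x , reduce-correct y

  ⌜⌝ᵛ-injective : ∀ {u v} → ⌜ u ⌝ᵛ ≈ᵛ ⌜ v ⌝ᵛ → u ≡ v
  ⌜⌝ᵛ-injective (x≈ , y≈) = cong₂ _,_ (⌜⌝-injective x≈) (⌜⌝-injective y≈)

  ⌜⌝-+ᵛ : ∀ u v → ⌜ u +V v ⌝ᵛ ≈ᵛ ⌜ u ⌝ᵛ +ᵛ ⌜ v ⌝ᵛ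
  ⌜⌝-+ᵛ (x , y) (x′ , y′) = ⌜⌝-+ x x′ , ⌜⌝-+ y y′

  ⌜⌝--ᵛ : ∀ u v → ⌜ u -V v ⌝ᵛ ≈ᵛ ⌜ u ⌝ᵛ -ᵛ ⌜ v ⌝ᵛ
  ⌜⌝--ᵛ (x , y) (x′ , y′) = ⌜⌝-- x x′ , ⌜⌝-- y y′

  ⌜⌝-act : ∀ A v → ⌜ act A v ⌝ᵛ ≈ᵛ actᶻ ⌜ A ⌝ᴹ ⌜ v ⌝ᵛ
  ⌜⌝-act (a , b , c , d) (x , y) = ⌜⌝-dot a x b y , ⌜⌝-dot c x d y

  ⌜⌝-· : ∀ A B → ⌜ A · B ⌝ᴹ ≈ᴹ ⌜ A ⌝ᴹ ·ᶻ ⌜ B ⌝ᴹ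
  ⌜⌝-· (a , b , c , d) (a′ , b′ , c′ , d′) =
    ⌜⌝-dot a a′ b c′ , ⌜⌝-dot a b′ b d′ , ⌜⌝-dot c a′ d c′ , ⌜⌝-dot c b′ d d′

  ⌜coboundary⌝ : ∀ A m → ⌜ act A m -V m ⌝ᵛ ≈ᵛ actᶻ ⌜ A ⌝ᴹ ⌜ m ⌝ᵛ -ᵛ ⌜ m ⌝ᵛ
  ⌜coboundary⌝ A m = ≈ᵛ-trans (⌜⌝--ᵛ (act A m) m) (-ᵛ-cong (⌜⌝-act A m) (≈ᵛ-refl {⌜ m ⌝ᵛ}))

  Iᶻ≈I : Iᶻ ≈ᴹ ⌜ I ⌝ᴹ
  Iᶻ≈I = mod-sym (⌜mod⌝ 1) , mod-sym (⌜mod⌝ 0) , mod-sym (⌜mod⌝ 0) , mod-sym (⌜mod⌝ 1)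

  gᶻ≈g : gᶻ ≈ᴹ ⌜ g ⌝ᴹ
  gᶻ≈g = mod-sym (⌜mod⌝ 1) , mod-sym (⌜mod⌝ 0) , mod-sym (⌜mod⌝ 0) ,
         mod-sym (mod-trans (⌜⌝-neg [ 1 ]) (neg-cong (⌜mod⌝ 1)))

  private
    ⌜1+p⌝ : ⌜ [ 1 ℕ.+ p ] ⌝ ≈ + 1 + + p
    ⌜1+p⌝ = mod-trans (⌜mod⌝ (1 ℕ.+ p)) (≡⇒≡mod (ℤ.pos-+ 1 p))

  σᶻ≈σ : σᶻ ≈ᴹ ⌜ σ ⌝ᴹ
  σᶻ≈σ = mod-sym ⌜1+p⌝ , mod-sym (⌜mod⌝ 1) ,
         mod-sym (mod-trans (⌜mod⌝ (2 ℕ.* p)) (≡⇒≡mod (ℤ.pos-* 2 p))) , mod-sym ⌜1+p⌝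

  hᶻ≈h : hᶻ ≈ᴹ ⌜ h ⌝ᴹ
  hᶻ≈h = mod-sym ⌜1+p⌝ , mod-sym (⌜mod⌝ 0) , mod-sym (⌜mod⌝ 0) ,
         mod-sym (mod-trans (⌜⌝-- [ 1 ] [ p ]) (+-cong (⌜mod⌝ 1) (neg-cong (⌜mod⌝ p))))

module Construction (p : ℕ) {{_ : NonZero p}} where
  open Setup p
  open IntegerMatrices (+ p)
  open Representatives p

  Z : Mat → V
  Z A = reduceᵛ (Zᶻ ⌜ A ⌝ᴹ)

  G⊆Γ : ∀ {A} → InG A → ∃[ s ] InΓ ⟦ s ⟧ ⌜ A ⌝ᴹ
  G⊆Γ G-one = Sign.+ , InΓ-cong Iᶻ≈I I∈Γ
  G⊆Γ G-g   = Sign.- , InΓ-cong gᶻ≈g g∈Γ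
  G⊆Γ G-σ   = Sign.+ , InΓ-cong σᶻ≈σ σ∈Γ
  G⊆Γ G-h   = Sign.+ , InΓ-cong hᶻ≈h h∈Γ
  G⊆Γ (G-mul {A} {B} A∈G B∈G) with G⊆Γ A∈G | G⊆Γ B∈G
  ... | s , A∈Γ | t , B∈Γ = s Sign.* t , InΓ-cong (≈ᴹ-sym (⌜⌝-· A B)) (Γ-closed s t A∈Γ B∈Γ)

  Z-cocycle : IsCocycle Z
  Z-cocycle {A} {B} A∈G B∈G with G⊆Γ A∈G | G⊆Γ B∈G
  ... | s , A∈Γ | t , B∈Γ = ⌜⌝ᵛ-injective (begin
    ⌜ Z (A · B) ⌝ᵛ                           ≈⟨ reduceᵛ-correct (Zᶻ ⌜ A · B ⌝ᴹ) ⟩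
    Zᶻ ⌜ A · B ⌝ᴹ                            ≈⟨ Zᶻ-cong (⌜⌝-· A B) ⟩
    Zᶻ (⌜ A ⌝ᴹ ·ᶻ ⌜ B ⌝ᴹ)                    ≈⟨ cocycle-identity s t A∈Γ B∈Γ ⟩
    Zᶻ ⌜ A ⌝ᴹ +ᵛ actᶻ ⌜ A ⌝ᴹ (Zᶻ ⌜ B ⌝ᴹ)     ≈⟨ +ᵛ-cong (reduceᵛ-correct (Zᶻ ⌜ A ⌝ᴹ))
                                                          (act-cong (≈ᴹ-refl {⌜ A ⌝ᴹ})
                                                                    (reduceᵛ-correct (Zᶻ ⌜ B ⌝ᴹ))) ⟨
    ⌜ Z A ⌝ᵛ +ᵛ actᶻ ⌜ A ⌝ᴹ ⌜ Z B ⌝ᵛ         ≈⟨ +ᵛ-cong (≈ᵛ-refl {⌜ Z A ⌝ᵛ}) (⌜⌝-act A (Z B)) ⟨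
    ⌜ Z A ⌝ᵛ +ᵛ ⌜ act A (Z B) ⌝ᵛ             ≈⟨ ⌜⌝-+ᵛ (Z A) (act A (Z B)) ⟨
    ⌜ Z A +V act A (Z B) ⌝ᵛ                  ∎)
    where open SetoidReasoning vecSetoid

  Z-local : (∀ b → b ≡ + 0 mod + p ⊎ ∃[ u ] u * b ≡ + 1 mod + p * + p) → SatisfiesLocal Z
  Z-local dichotomy {A} A∈G with G⊆Γ A∈G
  ... | s , A∈Γ with local-condition dichotomy s A∈Γ
  ... | m , Z≈ = reduceᵛ m , ⌜⌝ᵛ-injective (begin
    ⌜ Z A ⌝ᵛ                                      ≈⟨ reduceᵛ-correct (Zᶻ ⌜ A ⌝ᴹ) ⟩
    Zᶻ ⌜ A ⌝ᴹ                                     ≈⟨ Z≈ ⟩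
    actᶻ ⌜ A ⌝ᴹ m -ᵛ m                            ≈⟨ -ᵛ-cong (act-cong (≈ᴹ-refl {⌜ A ⌝ᴹ}) m≈) m≈ ⟩
    actᶻ ⌜ A ⌝ᴹ ⌜ reduceᵛ m ⌝ᵛ -ᵛ ⌜ reduceᵛ m ⌝ᵛ  ≈⟨ ⌜coboundary⌝ A (reduceᵛ m) ⟨
    ⌜ act A (reduceᵛ m) -V reduceᵛ m ⌝ᵛ           ∎)
    where
      open SetoidReasoning vecSetoid
      m≈ = ≈ᵛ-sym (reduceᵛ-correct m)

  Z-not-coboundary : 3 ℕ.≤ p → ¬ IsCoboundary Z
  Z-not-coboundary 3≤p (m , Z≡dm) =
    two-p-incongruent 3≤p
      (coboundary-obstruction (at gᶻ≈g (Z≡dm G-g)) (at σᶻ≈σ (Z≡dm G-σ)) (at hᶻ≈h (Z≡dm G-h)))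
    where
      open SetoidReasoning vecSetoid
      m≈m = ≈ᵛ-refl {⌜ m ⌝ᵛ}
      at : ∀ {A Aᶻ} → Aᶻ ≈ᴹ ⌜ A ⌝ᴹ → Z A ≡ act A m -V m → Zᶻ Aᶻ ≈ᵛ actᶻ Aᶻ ⌜ m ⌝ᵛ -ᵛ ⌜ m ⌝ᵛ
      at {A} {Aᶻ} Aᶻ≈A Z≡ = begin
        Zᶻ Aᶻ                         ≈⟨ Zᶻ-cong Aᶻ≈A ⟩
        Zᶻ ⌜ A ⌝ᴹ                     ≈⟨ reduceᵛ-correct (Zᶻ ⌜ A ⌝ᴹ) ⟨
        ⌜ Z A ⌝ᵛ                      ≡⟨ cong ⌜_⌝ᵛ Z≡ ⟩
        ⌜ act A m -V m ⌝ᵛ             ≈⟨ ⌜coboundary⌝ A m ⟩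
        actᶻ ⌜ A ⌝ᴹ ⌜ m ⌝ᵛ -ᵛ ⌜ m ⌝ᵛ  ≈⟨ -ᵛ-cong (act-cong Aᶻ≈A m≈m) m≈m ⟨
        actᶻ Aᶻ ⌜ m ⌝ᵛ -ᵛ ⌜ m ⌝ᵛ      ∎

lemma11 : (p : ℕ) (pr : Prime p) → 5 ≤ p →
    let open Setup p {{primeNZ pr}} in
    ∃[ Z ] (IsCocycle Z × SatisfiesLocal Z × ¬ IsCoboundary Z)
lemma11 p pr 5≤p =
  Z , Z-cocycle , Z-local (multiple-or-unit² pr) , Z-not-coboundary (ℕ.≤-trans (ℕ.m≤m+n 3 2) 5≤p)
  where open Construction p {{primeNZ pr}}
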